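{- Let $F$ be an unsatisfiable $(3,4)$-formula. Then there is an unsatisfiable $(3,4)$-formula $F'$ with $|F'|\leq |F|$ in which at most one variable has degree $2$. The same holds with $(3,2,2)$-formulas in place of $(3,4)$-formulas.
   Context: A literal is a propositional variable $x$ or its negation $\overline{x}$; a clause is a finite set of literals not containing both a literal and its negation; a CNF formula is a finite set of clauses, and $|F|$ is its number of clauses. A $(k,s)$-formula is a CNF formula in which every clause contains exactly $k$ distinct literals and every variable occurs (positively or negatively) in at most $s$ clauses. A $(k,p,q)$-formula is a CNF formula in which every clause contains exactly $k$ distinct literals and every variable occurs positively in at most $p$ clauses and negatively in at most $q$ clauses. The degree of a variable in $F$ is the number of clauses of $F$ in which it occurs (positively or negatively). -}

module Defs where

open import Data.Nat using (ℕ; _≤_; _≟_)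
open import Data.Bool using (Bool; true; false; T; _∨_)
open import Data.Bool.Properties using () renaming (_≟_ to _≟ᵇ_)
open import Data.Product using (_×_; _,_; proj₁; proj₂; Σ)
open import Data.Product.Properties using (≡-dec)
open import Data.List using (List; length; filter; any)
open import Data.List.Relation.Unary.Any using (Any)
open import Data.List.Relation.Unary.All using (All)
open import Data.List.Relation.Unary.Any using () renaming (any? to anyDec?)
open import Data.List.Relation.Unary.AllPairs using (AllPairs)
open import Data.List.Relation.Unary.Unique.Propositional using (Unique)
open import Data.List.Relation.Binary.Permutation.Propositional using (_↭_)
open import Relation.Binary.Definitions using (DecidableEquality)
open import Relation.Binary.PropositionalEquality using (_≡_)
open import Relation.Nullary using (¬_)
import Data.List.Membership.DecPropositional as DecMem

-- Variables are natural numbers. A literal is a pair (x , b):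
-- (x , true) is the positive literal x, (x , false) is its negation.
Var : Set
Var = ℕ

Literal : Set
Literal = Var × Bool

_≟ₗ_ : DecidableEquality Literal
_≟ₗ_ = ≡-dec _≟_ _≟ᵇ_

open DecMem _≟ₗ_ public using (_∈_; _∈?_)

Clause : Set
Clause = List Literal

Formula : Set
Formula = List Clause

IsClause : Clause → Set
IsClause C = Unique C × (∀ x → ¬ ((x , true) ∈ C × (x , false) ∈ C))

-- Well-formed formula: every entry is a clause, and no clause is listed twice
-- (two lists represent the same clause iff they are permutations of each other).
IsFormula : Formula → Set
IsFormula F = All IsClause F × AllPairs (λ C D → ¬ (C ↭ D)) F

size : Formula → ℕ
size F = length F

Assignment : Set
Assignment = Var → Bool

litTrue : Assignment → Literal → Set
litTrue α (x , b) = α x ≡ b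

Satisfies : Assignment → Formula → Set
Satisfies α F = All (λ C → Any (litTrue α) C) F

Unsatisfiable : Formula → Set
Unsatisfiable F = ∀ (α : Assignment) → ¬ Satisfies α F

degree : Formula → Var → ℕ
degree F x = length (filter (λ C → anyDec? (λ l → proj₁ l ≟ x) C) F)

posOcc : Formula → Var → ℕ
posOcc F x = length (filter (λ C → (x , true) ∈? C) F)

negOcc : Formula → Var → ℕ
negOcc F x = length (filter (λ C → (x , false) ∈? C) F)

Uniform : ℕ → Formula → Set
Uniform k F = All (λ C → length C ≡ k) F

IsKS : ℕ → ℕ → Formula → Set
IsKS k s F = IsFormula F × Uniform k F × (∀ x → degree F x ≤ s)

IsKPQ : ℕ → ℕ → ℕ → Formula → Set
IsKPQ k p q F = IsFormula F × Uniform k F × (∀ x → posOcc F x ≤ p × negOcc F x ≤ q)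

AtMostOneDeg2 : Formula → Set
AtMostOneDeg2 F = ∀ x y → degree F x ≡ 2 → degree F y ≡ 2 → x ≡ y

-- Take two distinct variables x < y of degree 2. If one of them is pure,
-- the clauses containing it can be satisfied by that variable alone, so deleting them keeps the formula
-- unsatisfiable. Otherwise each occurs exactly once positively and once negatively, and substituting x or
-- its negation for y (the sign chosen so that no clause gets a repeated literal), then deleting
-- tautologies and subsumed clauses, keeps the formula unsatisfiable: a satisfying assignment of the result
-- extends to one of F by setting y from x. Neither step adds clauses, the occurrence bounds survive since x
-- inherits at most the two occurrences of y, and with y > x the total weight Σ (variable + 1) strictly
-- decreases, so iterating ends in a formula with at most one variable of degree 2.
module Submission where

open import Defs
open import Data.Nat using (_≤_)
open import Data.Product using (_×_; Σ)

open import Level using (0ℓ)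
open import Function using (_∘_; id)
open import Data.Empty using (⊥; ⊥-elim)
open import Data.Nat using (ℕ; suc; _<_; _+_; z≤n; s≤s; _≟_)
open import Data.Nat.Properties
open import Data.Nat.Induction using (<-wellFounded)
open import Induction.WellFounded using (Acc; acc)
open import Data.Nat.ListAction using (sum)
open import Data.Bool using (Bool; true; false; not; _xor_)
open import Data.Bool.Properties using (not-involutive; ¬-not; not-distribˡ-xor; xor-annihilates-not)
  renaming (_≟_ to _≟ᵇ_)
open import Data.Product using (∃; ∃₂; _,_; proj₁; proj₂)
open import Data.Sum using (_⊎_; inj₁; inj₂; [_,_]′)
open import Data.List using (List; []; _∷_; length; filter; map; concat)
open import Data.List.Properties using (length-map; length-filter; filter-some; filter-none; filter-accept)
open import Data.List.Membership.Propositional using (find; lose) renaming (_∈_ to _∈ᴸ_)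
open import Data.List.Membership.Propositional.Properties using (∈-map⁻)
open import Data.List.Relation.Unary.Any as Any using (Any; here; there; any?; satisfied)
import Data.List.Relation.Unary.Any.Properties as AnyP
open import Data.List.Relation.Unary.All as All using (All; []; _∷_; all?)
open import Data.List.Relation.Unary.All.Properties using (¬Any⇒All¬; all-filter)
  renaming (map⁺ to All-map⁺; map⁻ to All-map⁻; filter⁺ to AllFilter⁺; filter⁻ to All-filter⁻)
open import Data.List.Relation.Unary.AllPairs using (AllPairs; []; _∷_)
open import Data.List.Relation.Unary.Unique.Propositional using (Unique)
open import Data.List.Relation.Binary.Permutation.Propositional using (_↭_; ↭-sym)
open import Data.List.Relation.Binary.Permutation.Propositional.Properties using (∈-resp-↭)
open import Data.List.Relation.Binary.Sublist.Propositional using (_⊆_; []; _∷_; _∷ʳ_; ⊆-refl; ⊆-trans)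
open import Data.List.Relation.Binary.Sublist.Propositional.Properties
  using (All-resp-⊆; filter-⊆; length-mono-≤) renaming (filter⁺ to filter-⊆⁺)
open import Relation.Nullary using (¬_; Dec; yes; no; does; ¬?; contradiction)
open import Relation.Nullary.Decidable using (_×-dec_; _⊎-dec_; map′; decidable-stable)
open import Relation.Unary using (Pred; Decidable)
open import Relation.Binary.Definitions using (tri<; tri≈; tri>)
open import Relation.Binary.PropositionalEquality
  using (_≡_; _≢_; refl; sym; trans; cong; subst; ≢-sym)

module _ {A : Set} where

  AllPairs-resp-⊇ : ∀ {R : A → A → Set} {xs ys} → xs ⊆ ys → AllPairs R ys → AllPairs R xs
  AllPairs-resp-⊇ [] [] = []
  AllPairs-resp-⊇ (_ ∷ʳ xs⊆ys) (_ ∷ ps) = AllPairs-resp-⊇ xs⊆ys ps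
  AllPairs-resp-⊇ (refl ∷ xs⊆ys) (p ∷ ps) = All-resp-⊆ xs⊆ys p ∷ AllPairs-resp-⊇ xs⊆ys ps

  All×Any⇒Any× : ∀ {P Q : Pred A 0ℓ} {xs} → All P xs → Any Q xs → Any (λ x → P x × Q x) xs
  All×Any⇒Any× (px ∷ _) (here qx) = here (px , qx)
  All×Any⇒Any× (_ ∷ ps) (there q) = there (All×Any⇒Any× ps q)

  Unique-map⁺ : ∀ {B : Set} {f : A → B} {xs} →
                (∀ {a b} → a ∈ᴸ xs → b ∈ᴸ xs → f a ≡ f b → a ≡ b) → Unique xs → Unique (map f xs)
  Unique-map⁺ {xs = []} inj [] = []
  Unique-map⁺ {xs = x ∷ xs} inj (x∉xs ∷ u) =
    All-map⁺ (All.tabulate λ b∈xs fx≡fb → All.lookup x∉xs b∈xs (inj (here refl) (there b∈xs) fx≡fb))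
    ∷ Unique-map⁺ (λ a∈xs b∈xs → inj (there a∈xs) (there b∈xs)) u

module _ {A : Set} {P : Pred A 0ℓ} (P? : Decidable P) where

  count : List A → ℕ
  count xs = length (filter P? xs)

  count-accept : ∀ {x xs} → P x → count (x ∷ xs) ≡ suc (count xs)
  count-accept px = cong length (filter-accept P? px)

  count-mono-⊆ : ∀ {xs ys} → xs ⊆ ys → count xs ≤ count ys
  count-mono-⊆ xs⊆ys = length-mono-≤ (filter-⊆⁺ P? P? (λ { refl p → p }) xs⊆ys)

  count-∷ : ∀ {x xs} → count xs ≤ count (x ∷ xs)
  count-∷ {x} = count-mono-⊆ (x ∷ʳ ⊆-refl)

  count-pos⇒Any : ∀ xs → 0 < count xs → Any P xs
  count-pos⇒Any xs 0<count with any? P? xs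
  ... | yes p = p
  ... | no ¬p = contradiction (sym (cong length (filter-none P? (¬Any⇒All¬ xs ¬p)))) (<⇒≢ 0<count)

  count≡0⇒All¬ : ∀ xs → count xs ≡ 0 → All (¬_ ∘ P) xs
  count≡0⇒All¬ xs count≡0 = ¬Any⇒All¬ xs λ p → <⇒≢ (filter-some P? p) (sym count≡0)

  count≤1⇒unique : ∀ {xs a b} → count xs ≤ 1 → a ∈ᴸ xs → b ∈ᴸ xs → P a → P b → a ≡ b
  count≤1⇒unique {x ∷ xs} c≤1 (here refl) (here refl) pa pb = refl
  count≤1⇒unique {x ∷ xs} c≤1 (here refl) (there b∈xs) pa pb =
    ⊥-elim (<⇒≱ (filter-some P? (lose b∈xs pb)) (≤-pred (subst (_≤ 1) (count-accept pa) c≤1)))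
  count≤1⇒unique {x ∷ xs} c≤1 (there a∈xs) (here refl) pa pb =
    sym (count≤1⇒unique c≤1 (here refl) (there a∈xs) pb pa)
  count≤1⇒unique {x ∷ xs} c≤1 (there a∈xs) (there b∈xs) pa pb =
    count≤1⇒unique (≤-trans count-∷ c≤1) a∈xs b∈xs pa pb

  count-map : ∀ {B : Set} (f : B → A) xs → count (map f xs) ≡ length (filter (P? ∘ f) xs)
  count-map f [] = refl
  count-map f (x ∷ xs) with does (P? (f x))
  ... | true = cong suc (count-map f xs)
  ... | false = count-map f xs

module _ {A : Set} {P Q R : Pred A 0ℓ} (P? : Decidable P) (Q? : Decidable Q) (R? : Decidable R) where

  count-⊎ : (∀ {x} → P x → Q x ⊎ R x) → ∀ xs → count P? xs ≤ count Q? xs + count R? xs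
  count-⊎ P⇒Q⊎R [] = z≤n
  count-⊎ P⇒Q⊎R (x ∷ xs) with ih ← count-⊎ P⇒Q⊎R xs | P? x
  ... | no _ = ≤-trans ih (+-mono-≤ (count-∷ Q?) (count-∷ R?))
  ... | yes px with P⇒Q⊎R px
  ...   | inj₁ qx = begin
    suc (count P? xs)               ≤⟨ s≤s ih ⟩
    suc (count Q? xs + count R? xs) ≤⟨ +-mono-≤ (≤-reflexive (sym (count-accept Q? qx))) (count-∷ R?) ⟩
    count Q? (x ∷ xs) + count R? (x ∷ xs) ∎
    where open ≤-Reasoning
  ...   | inj₂ rx = begin
    suc (count P? xs)               ≤⟨ s≤s ih ⟩
    suc (count Q? xs + count R? xs) ≡⟨ +-suc (count Q? xs) (count R? xs) ⟨
    count Q? xs + suc (count R? xs) ≤⟨ +-mono-≤ (count-∷ Q?) (≤-reflexive (sym (count-accept R? rx))) ⟩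
    count Q? (x ∷ xs) + count R? (x ∷ xs) ∎
    where open ≤-Reasoning

  count-disjoint : (∀ {x} → P x → R x) → (∀ {x} → Q x → R x) →
                   ∀ {xs} → All (λ x → ¬ (P x × Q x)) xs → count P? xs + count Q? xs ≤ count R? xs
  count-disjoint P⇒R Q⇒R [] = z≤n
  count-disjoint P⇒R Q⇒R {x ∷ xs} (¬PQx ∷ ¬PQ) with ih ← count-disjoint P⇒R Q⇒R ¬PQ | P? x | Q? x
  ... | yes px | yes qx = ⊥-elim (¬PQx (px , qx))
  ... | yes px | no _ = ≤-trans (s≤s ih) (≤-reflexive (sym (count-accept R? (P⇒R px))))
  ... | no _ | yes qx = begin
    count P? xs + suc (count Q? xs) ≡⟨ +-suc (count P? xs) (count Q? xs) ⟩
    suc (count P? xs + count Q? xs) ≤⟨ s≤s ih ⟩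
    suc (count R? xs)               ≡⟨ count-accept R? (Q⇒R qx) ⟨
    count R? (x ∷ xs)               ∎
    where open ≤-Reasoning
  ... | no _ | no _ = ≤-trans ih (count-∷ R?)

module _ {A : Set} {P Q : Pred A 0ℓ} (P? : Decidable P) (Q? : Decidable Q) where

  count-mono : (∀ {x} → P x → Q x) → ∀ xs → count P? xs ≤ count Q? xs
  count-mono P⇒Q xs = length-mono-≤ (filter-⊆⁺ P? Q? (λ { refl p → P⇒Q p }) (⊆-refl {x = xs}))

module _ {A : Set} (g : A → ℕ) where

  sum-map-mono-⊆ : ∀ {xs ys} → xs ⊆ ys → sum (map g xs) ≤ sum (map g ys)
  sum-map-mono-⊆ [] = z≤n
  sum-map-mono-⊆ (y ∷ʳ xs⊆ys) = ≤-trans (sum-map-mono-⊆ xs⊆ys) (m≤n+m _ (g y))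
  sum-map-mono-⊆ (refl ∷ xs⊆ys) = +-monoʳ-≤ _ (sum-map-mono-⊆ xs⊆ys)

  sum-map-filter-< : ∀ {P : Pred A 0ℓ} (P? : Decidable P) {xs} → Any (λ x → ¬ P x × 0 < g x) xs →
                     sum (map g (filter P? xs)) < sum (map g xs)
  sum-map-filter-< P? {x ∷ xs} (here (¬px , 0<gx)) with P? x
  ... | yes px = contradiction px ¬px
  ... | no _ = ≤-trans (s≤s (sum-map-mono-⊆ (filter-⊆ P? xs))) (+-monoˡ-≤ _ 0<gx)
  sum-map-filter-< P? {x ∷ xs} (there p) with P? x
  ... | yes _ = +-monoʳ-< (g x) (sum-map-filter-< P? p)
  ... | no _ = ≤-trans (sum-map-filter-< P? p) (m≤n+m _ (g x))

  module _ {f : A → A} (decreasing : ∀ x → g (f x) ≤ g x) where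

    sum-map-map-≤ : ∀ xs → sum (map g (map f xs)) ≤ sum (map g xs)
    sum-map-map-≤ [] = z≤n
    sum-map-map-≤ (x ∷ xs) = +-mono-≤ (decreasing x) (sum-map-map-≤ xs)

    sum-map-map-< : ∀ {xs} → Any (λ x → g (f x) < g x) xs → sum (map g (map f xs)) < sum (map g xs)
    sum-map-map-< {x ∷ xs} (here gfx<gx) = +-mono-<-≤ gfx<gx (sum-map-map-≤ xs)
    sum-map-map-< {x ∷ xs} (there p) = +-mono-≤-< (decreasing x) (sum-map-map-< p)

Mentions : Var → Clause → Set
Mentions v C = Any (λ l → proj₁ l ≡ v) C

mentions? : (v : Var) → Decidable (Mentions v)
mentions? v C = any? (λ l → proj₁ l ≟ v) C

occ : Formula → Literal → ℕ
occ F l = count (l ∈?_) F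

AtMostOnce : Formula → Var → Set
AtMostOnce F v = ∀ b → occ F (v , b) ≤ 1

complement : Literal → Literal
complement (v , b) = (v , not b)

∈⇒Mentions : ∀ {v b C} → (v , b) ∈ C → Mentions v C
∈⇒Mentions = Any.map λ { refl → refl }

Mentions⇒∈ : ∀ {v C} → Mentions v C → ∃ λ b → (v , b) ∈ C
Mentions⇒∈ m with find m
... | (_ , b) , l∈C , refl = b , l∈C

Mentions⇒∈-⊎ : ∀ {v C} → Mentions v C → (v , true) ∈ C ⊎ (v , false) ∈ C
Mentions⇒∈-⊎ m with Mentions⇒∈ m
... | true , l∈C = inj₁ l∈C
... | false , l∈C = inj₂ l∈C

IsClause-consistent : ∀ {C} → IsClause C → ∀ {v} b → (v , b) ∈ C → ¬ (v , not b) ∈ C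
IsClause-consistent (_ , consistent) true p n = consistent _ (p , n)
IsClause-consistent (_ , consistent) false n p = consistent _ (p , n)

IsFormula-⊆ : ∀ {F G} → G ⊆ F → IsFormula F → IsFormula G
IsFormula-⊆ G⊆F (clauses , distinct) = All-resp-⊆ G⊆F clauses , AllPairs-resp-⊇ G⊆F distinct

degree≤occ+occ : ∀ F v → degree F v ≤ occ F (v , true) + occ F (v , false)
degree≤occ+occ F v = count-⊎ (mentions? v) ((v , true) ∈?_) ((v , false) ∈?_) Mentions⇒∈-⊎ F

occ+occ≤degree : ∀ {F} → All IsClause F → ∀ v → occ F (v , true) + occ F (v , false) ≤ degree F v
occ+occ≤degree clauses v =
  count-disjoint ((v , true) ∈?_) ((v , false) ∈?_) (mentions? v) ∈⇒Mentions ∈⇒Mentions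
                 (All.map (λ clause → proj₂ clause v) clauses)

AtMostOnce⇒degree≤2 : ∀ {F v} → AtMostOnce F v → degree F v ≤ 2
AtMostOnce⇒degree≤2 {F} {v} once = ≤-trans (degree≤occ+occ F v) (+-mono-≤ (once true) (once false))

summand≤1 : ∀ {a c} → a + c ≤ 2 → c ≢ 0 → a ≤ 1
summand≤1 {a} {c} a+c≤2 c≢0 = ≤-pred (begin
  suc a ≡⟨ +-comm 1 a ⟩
  a + 1 ≤⟨ +-monoʳ-≤ a (n≢0⇒n>0 c≢0) ⟩
  a + c ≤⟨ a+c≤2 ⟩
  2     ∎)
  where open ≤-Reasoning

pure⊎AtMostOnce : ∀ {F} → All IsClause F → ∀ v → degree F v ≡ 2 →
                  (∃ λ b → occ F (v , not b) ≡ 0) ⊎ AtMostOnce F v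
pure⊎AtMostOnce {F} clauses v degree≡2 with occ F (v , true) ≟ 0 | occ F (v , false) ≟ 0
... | yes pos≡0 | _ = inj₁ (false , pos≡0)
... | no _ | yes neg≡0 = inj₁ (true , neg≡0)
... | no pos≢0 | no neg≢0 = inj₂ λ
  { true → summand≤1 pos+neg≤2 neg≢0
  ; false → summand≤1 (subst (_≤ 2) (+-comm (occ F (v , true)) _) pos+neg≤2) pos≢0 }
  where
  pos+neg≤2 : occ F (v , true) + occ F (v , false) ≤ 2
  pos+neg≤2 = subst (occ F (v , true) + occ F (v , false) ≤_) degree≡2 (occ+occ≤degree clauses v)

degree≡2⇒Any-Mentions : ∀ F {v} → degree F v ≡ 2 → Any (Mentions v) F
degree≡2⇒Any-Mentions F degree≡2 = count-pos⇒Any (mentions? _) F (subst (0 <_) (sym degree≡2) (s≤s z≤n))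

_[_≔_] : Assignment → Var → Bool → Assignment
(α [ v ≔ b ]) w with w ≟ v
... | yes _ = b
... | no _ = α w

update-same : ∀ α v b → (α [ v ≔ b ]) v ≡ b
update-same α v b with v ≟ v
... | yes _ = refl
... | no v≢v = contradiction refl v≢v

update-other : ∀ α {v w} b → w ≢ v → (α [ v ≔ b ]) w ≡ α w
update-other α {v} {w} b w≢v with w ≟ v
... | yes w≡v = contradiction w≡v w≢v
... | no _ = refl

Any-update : ∀ {α v b C} → ¬ Mentions v C → Any (litTrue α) C → Any (litTrue (α [ v ≔ b ])) C
Any-update {α} {b = b} ¬mentions (here h) = here (trans (update-other α b (¬mentions ∘ here)) h)
Any-update ¬mentions (there p) = there (Any-update (¬mentions ∘ there) p)

Tautology : Clause → Set
Tautology C = Any (λ l → complement l ∈ C) C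

tautology? : Decidable Tautology
tautology? C = any? (λ l → complement l ∈? C) C

Tautology-satisfied : ∀ α {C} → Tautology C → Any (litTrue α) C
Tautology-satisfied α taut with find taut
... | (v , b) , l∈C , lᶜ∈C with α v ≟ᵇ b
...   | yes αv≡b = lose l∈C αv≡b
...   | no αv≢b = lose lᶜ∈C (¬-not αv≢b)

removeTautologies : Formula → Formula
removeTautologies = filter (¬? ∘ tautology?)

removeTautologies-reflects : ∀ α F → Satisfies α (removeTautologies F) → Satisfies α F
removeTautologies-reflects α F sat = All-filter⁻ (¬? ∘ tautology?) sat
  (All.map (Tautology-satisfied α ∘ decidable-stable (tautology? _)) (all-filter (¬? ∘ ¬? ∘ tautology?) F))

removeTautologies-IsClause : ∀ {F} → All (λ C → ¬ Tautology C → IsClause C) F →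
                             All IsClause (removeTautologies F)
removeTautologies-IsClause {F} h = All.zipWith (λ (isClause , ¬taut) → isClause ¬taut)
  (AllFilter⁺ (¬? ∘ tautology?) h , all-filter (¬? ∘ tautology?) F)

Subsumes : Clause → Clause → Set
Subsumes D C = All (_∈ C) D

subsumes? : ∀ D C → Dec (Subsumes D C)
subsumes? D C = all? (_∈? C) D

removeSubsumed : Formula → Formula
removeSubsumed [] = []
removeSubsumed (C ∷ F) with any? (λ D → subsumes? D C) (removeSubsumed F)
... | yes _ = removeSubsumed F
... | no _ = C ∷ removeSubsumed F

removeSubsumed-⊆ : ∀ F → removeSubsumed F ⊆ F
removeSubsumed-⊆ [] = []
removeSubsumed-⊆ (C ∷ F) with any? (λ D → subsumes? D C) (removeSubsumed F)
... | yes _ = C ∷ʳ removeSubsumed-⊆ F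
... | no _ = refl ∷ removeSubsumed-⊆ F

removeSubsumed-reflects : ∀ α F → Satisfies α (removeSubsumed F) → Satisfies α F
removeSubsumed-reflects α [] [] = []
removeSubsumed-reflects α (C ∷ F) sat with any? (λ D → subsumes? D C) (removeSubsumed F)
... | yes subsumed =
  let satD , D⊆C = All.lookupAny sat subsumed
      l∈C , l-true = All.lookupAny D⊆C satD
  in lose l∈C l-true ∷ removeSubsumed-reflects α F sat
... | no _ with sat
...   | satC ∷ satF = satC ∷ removeSubsumed-reflects α F satF

removeSubsumed-distinct : ∀ F → AllPairs (λ C D → ¬ (C ↭ D)) (removeSubsumed F)
removeSubsumed-distinct [] = []
removeSubsumed-distinct (C ∷ F) with any? (λ D → subsumes? D C) (removeSubsumed F)
... | yes _ = removeSubsumed-distinct F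
... | no ¬subsumed =
  All.map (λ ¬D⊆C C↭D → ¬D⊆C (All.tabulate (∈-resp-↭ (↭-sym C↭D)))) (¬Any⇒All¬ _ ¬subsumed)
  ∷ removeSubsumed-distinct F

literalWeight : Literal → ℕ
literalWeight (v , _) = suc v

clauseWeight : Clause → ℕ
clauseWeight C = sum (map literalWeight C)

weight : Formula → ℕ
weight F = sum (map clauseWeight F)

xor-cancelˡ : ∀ t c → t xor (t xor c) ≡ c
xor-cancelˡ true c = not-involutive c
xor-cancelˡ false c = refl

-- Substituting x (if t is false) or ¬x (if t is true) for y.
module Identify (x y : Var) (t : Bool) where

  rename : Literal → Literal
  rename (v , c) with v ≟ y
  ... | yes _ = (x , t xor c)
  ... | no _ = (v , c)

  renameClause : Clause → Clause
  renameClause = map rename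

  renameFormula : Formula → Formula
  renameFormula = map renameClause

  -- Such a clause would contain x^(t xor c) twice after renaming.
  Collides : Clause → Set
  Collides C = ∃ λ c → (y , c) ∈ C × (x , t xor c) ∈ C

  collides? : Decidable Collides
  collides? C = map′ (λ { (inj₁ p) → true , p ; (inj₂ p) → false , p })
                     (λ { (true , p) → inj₁ p ; (false , p) → inj₂ p })
                     (((y , true) ∈? C ×-dec (x , t xor true) ∈? C) ⊎-dec
                      ((y , false) ∈? C ×-dec (x , t xor false) ∈? C))

  rename-fiber : ∀ l {w c} → rename l ≡ (w , c) → l ≡ (w , c) ⊎ (w ≡ x × l ≡ (y , t xor c))
  rename-fiber (v , c) eq with v ≟ y
  rename-fiber (v , c) refl | yes refl = inj₂ (refl , cong (y ,_) (sym (xor-cancelˡ t c)))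
  rename-fiber (v , c) eq | no _ = inj₁ eq

  ∈-renameClause : ∀ {C w c} → (w , c) ∈ renameClause C → (w , c) ∈ C ⊎ (w ≡ x × (y , t xor c) ∈ C)
  ∈-renameClause m with ∈-map⁻ rename m
  ... | l , l∈C , eq with rename-fiber l (sym eq)
  ...   | inj₁ refl = inj₁ l∈C
  ...   | inj₂ (w≡x , refl) = inj₂ (w≡x , l∈C)

  Mentions-renameClause : ∀ {C w} → Mentions w (renameClause C) → Mentions w C ⊎ (w ≡ x × Mentions y C)
  Mentions-renameClause m with ∈-renameClause (proj₂ (Mentions⇒∈ m))
  ... | inj₁ l∈C = inj₁ (∈⇒Mentions l∈C)
  ... | inj₂ (w≡x , l∈C) = inj₂ (w≡x , ∈⇒Mentions l∈C)

  rename-injectiveOn : ∀ {C} → ¬ Collides C →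
                       ∀ {l l′} → l ∈ C → l′ ∈ C → rename l ≡ rename l′ → l ≡ l′
  rename-injectiveOn {C} ¬collides {v , c} {v′ , c′} l∈C l′∈C eq with v ≟ y | v′ ≟ y
  ... | yes refl | yes refl =
    cong (y ,_) (trans (sym (xor-cancelˡ t c)) (trans (cong ((t xor_) ∘ proj₂) eq) (xor-cancelˡ t c′)))
  ... | yes refl | no _ = contradiction (c , l∈C , subst (_∈ C) (sym eq) l′∈C) ¬collides
  ... | no _ | yes refl = contradiction (c′ , l′∈C , subst (_∈ C) eq l∈C) ¬collides
  ... | no _ | no _ = eq

  renameClause-IsClause : ∀ {C} → IsClause C → ¬ Collides C → ¬ Tautology (renameClause C) →
                          IsClause (renameClause C)
  renameClause-IsClause (unique , _) ¬collides ¬taut =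
    Unique-map⁺ (rename-injectiveOn ¬collides) unique , λ v (p , n) → ¬taut (lose p n)

  renameFormula-Uniform : ∀ {k F} → Uniform k F → Uniform k (renameFormula F)
  renameFormula-Uniform uniform =
    All-map⁺ (All.map (λ {C} length≡k → trans (length-map rename C) length≡k) uniform)

  litTrue-rename : ∀ α l → litTrue α (rename l) → litTrue (α [ y ≔ t xor α x ]) l
  litTrue-rename α (v , c) h with v ≟ y
  ... | yes refl = trans (cong (t xor_) h) (xor-cancelˡ t c)
  ... | no v≢y = h

  renameFormula-reflects : ∀ α F → Satisfies α (renameFormula F) → Satisfies (α [ y ≔ t xor α x ]) F
  renameFormula-reflects α F sat =
    All.map (λ satC → Any.map (λ {l} → litTrue-rename α l) (AnyP.map⁻ satC)) (All-map⁻ sat)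

  occ-renameFormula-x : ∀ F c → occ (renameFormula F) (x , c) ≤ occ F (x , c) + occ F (y , t xor c)
  occ-renameFormula-x F c = ≤-trans (≤-reflexive (count-map ((x , c) ∈?_) renameClause F))
    (count-⊎ _ ((x , c) ∈?_) ((y , t xor c) ∈?_) ([ inj₁ , inj₂ ∘ proj₂ ]′ ∘ ∈-renameClause) F)

  occ-renameFormula-other : ∀ F {v} c → v ≢ x → occ (renameFormula F) (v , c) ≤ occ F (v , c)
  occ-renameFormula-other F c v≢x = ≤-trans (≤-reflexive (count-map (_ ∈?_) renameClause F))
    (count-mono _ (_ ∈?_) ([ id , ⊥-elim ∘ v≢x ∘ proj₁ ]′ ∘ ∈-renameClause) F)

  degree-renameFormula-x : ∀ F → degree (renameFormula F) x ≤ degree F x + degree F y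
  degree-renameFormula-x F = ≤-trans (≤-reflexive (count-map (mentions? x) renameClause F))
    (count-⊎ _ (mentions? x) (mentions? y) ([ inj₁ , inj₂ ∘ proj₂ ]′ ∘ Mentions-renameClause) F)

  degree-renameFormula-other : ∀ F {v} → v ≢ x → degree (renameFormula F) v ≤ degree F v
  degree-renameFormula-other F v≢x = ≤-trans (≤-reflexive (count-map (mentions? _) renameClause F))
    (count-mono _ (mentions? _) ([ id , ⊥-elim ∘ v≢x ∘ proj₁ ]′ ∘ Mentions-renameClause) F)

  module _ (x<y : x < y) where

    literalWeight-rename : ∀ l → literalWeight (rename l) ≤ literalWeight l
    literalWeight-rename (v , c) with v ≟ y
    ... | yes refl = s≤s (<⇒≤ x<y)
    ... | no _ = ≤-refl

    literalWeight-rename-< : ∀ {l} → proj₁ l ≡ y → literalWeight (rename l) < literalWeight l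
    literalWeight-rename-< {v , c} v≡y with v ≟ y
    ... | yes refl = s≤s x<y
    ... | no v≢y = contradiction v≡y v≢y

    clauseWeight-rename : ∀ C → clauseWeight (renameClause C) ≤ clauseWeight C
    clauseWeight-rename = sum-map-map-≤ literalWeight literalWeight-rename

    weight-renameFormula-< : ∀ {F} → Any (Mentions y) F → weight (renameFormula F) < weight F
    weight-renameFormula-< mentions = sum-map-map-< clauseWeight clauseWeight-rename
      (Any.map (sum-map-map-< literalWeight literalWeight-rename ∘ Any.map literalWeight-rename-<) mentions)

  merge : Formula → Formula
  merge F = removeSubsumed (removeTautologies (renameFormula F))

  merge-⊆ : ∀ F → merge F ⊆ renameFormula F
  merge-⊆ F = ⊆-trans (removeSubsumed-⊆ _) (filter-⊆ (¬? ∘ tautology?) (renameFormula F))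

  merge-IsFormula : ∀ {F} → All IsClause F → All (¬_ ∘ Collides) F → IsFormula (merge F)
  merge-IsFormula {F} clauses ¬collides =
    All-resp-⊆ (removeSubsumed-⊆ (removeTautologies (renameFormula F)))
      (removeTautologies-IsClause (All-map⁺
        (All.zipWith (λ (clause , ¬c) → renameClause-IsClause clause ¬c) (clauses , ¬collides))))
    , removeSubsumed-distinct (removeTautologies (renameFormula F))

  merge-Unsatisfiable : ∀ F → Unsatisfiable F → Unsatisfiable (merge F)
  merge-Unsatisfiable F unsat α sat =
    unsat _ (renameFormula-reflects α F (removeTautologies-reflects α _ (removeSubsumed-reflects α _ sat)))

  merge-size : ∀ F → size (merge F) ≤ size F
  merge-size F = ≤-trans (length-mono-≤ (merge-⊆ F)) (≤-reflexive (length-map renameClause F))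

  merge-weight-< : x < y → ∀ {F} → Any (Mentions y) F → weight (merge F) < weight F
  merge-weight-< x<y {F} mentions =
    ≤-<-trans (sum-map-mono-⊆ clauseWeight (merge-⊆ F)) (weight-renameFormula-< x<y mentions)

open Identify using (renameFormula; Collides; collides?; merge)

-- Since x and y occur at most once with each sign, a collision for t and one for ¬t would share a clause,
-- which would then contain two complementary literals.
opposite-collisions : ∀ {F x y t} → All IsClause F → AtMostOnce F x → AtMostOnce F y →
                      Any (Collides x y t) F → Any (Collides x y (not t)) F → ⊥
opposite-collisions {F} {x} {y} {t} clauses x-once y-once p q with find p | find q
... | C , C∈F , c , yc∈C , xc∈C | D , D∈F , d , yd∈D , xd∈D with c ≟ᵇ d
...   | yes refl with count≤1⇒unique ((y , c) ∈?_) (y-once c) C∈F D∈F yc∈C yd∈D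
...     | refl = IsClause-consistent (All.lookup clauses C∈F) (t xor c) xc∈C
                   (subst (λ b → (x , b) ∈ C) (sym (not-distribˡ-xor t c)) xd∈D)
opposite-collisions {F} {x} {y} {t} clauses x-once y-once p q
  | C , C∈F , c , yc∈C , xc∈C | D , D∈F , d , yd∈D , xd∈D | no c≢d with ¬-not (≢-sym c≢d)
...   | refl with count≤1⇒unique ((x , t xor c) ∈?_) (x-once (t xor c)) C∈F D∈F xc∈C
                   (subst (λ b → (x , b) ∈ D) (xor-annihilates-not t c) xd∈D)
...     | refl = IsClause-consistent (All.lookup clauses C∈F) c yc∈C yd∈D

collisionFree-polarity : ∀ {F x y} → All IsClause F → AtMostOnce F x → AtMostOnce F y →
                         ∃ λ t → All (¬_ ∘ Collides x y t) F
collisionFree-polarity {F} {x} {y} clauses x-once y-once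
  with any? (collides? x y false) F | any? (collides? x y true) F
... | no ¬p | _ = false , ¬Any⇒All¬ F ¬p
... | yes _ | no ¬q = true , ¬Any⇒All¬ F ¬q
... | yes p | yes q = ⊥-elim (opposite-collisions clauses x-once y-once p q)

removeClausesWith : Literal → Formula → Formula
removeClausesWith l = filter (¬? ∘ (l ∈?_))

¬∈-both⇒¬Mentions : ∀ {v b C} → ¬ (v , b) ∈ C → ¬ (v , not b) ∈ C → ¬ Mentions v C
¬∈-both⇒¬Mentions {v} {b} ¬pos ¬neg m with Mentions⇒∈ m
... | c , l∈C with c ≟ᵇ b
...   | yes refl = ¬pos l∈C
...   | no c≢b = ¬neg (subst (λ c → (v , c) ∈ _) (¬-not c≢b) l∈C)

-- Making the pure literal true satisfies the removed clauses and leaves the other clauses untouched.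
removeClausesWith-pure-Unsatisfiable : ∀ F v b → occ F (v , not b) ≡ 0 → Unsatisfiable F →
                                       Unsatisfiable (removeClausesWith (v , b) F)
removeClausesWith-pure-Unsatisfiable F v b pure unsat α sat =
  unsat (α [ v ≔ b ]) (All-filter⁻ (¬? ∘ ((v , b) ∈?_)) kept removed)
  where
  kept : All (Any (litTrue (α [ v ≔ b ]))) (removeClausesWith (v , b) F)
  kept = All.zipWith (λ (satC , ¬pos , ¬neg) → Any-update (¬∈-both⇒¬Mentions ¬pos ¬neg) satC)
           (sat , All.zip (all-filter (¬? ∘ ((v , b) ∈?_)) F ,
                           AllFilter⁺ (¬? ∘ ((v , b) ∈?_)) (count≡0⇒All¬ _ F pure)))
  removed : All (Any (litTrue (α [ v ≔ b ]))) (filter (¬? ∘ ¬? ∘ ((v , b) ∈?_)) F)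
  removed = All.map (λ ¬¬pos → lose (decidable-stable ((v , b) ∈? _) ¬¬pos) (update-same α v b))
              (all-filter (¬? ∘ ¬? ∘ ((v , b) ∈?_)) F)

removeClausesWith-pure-weight-< : ∀ F v b → occ F (v , not b) ≡ 0 → Any (Mentions v) F →
                                  weight (removeClausesWith (v , b) F) < weight F
removeClausesWith-pure-weight-< F v b pure mentioned =
  sum-map-filter-< clauseWeight (¬? ∘ ((v , b) ∈?_))
    (Any.map (λ (¬neg , mentions) → (λ ¬pos → ¬∈-both⇒¬Mentions ¬pos ¬neg mentions) , nonempty mentions)
             (All×Any⇒Any× (count≡0⇒All¬ _ F pure) mentioned))
  where
  nonempty : ∀ {C} → Mentions v C → 0 < clauseWeight C
  nonempty (here _) = s≤s z≤n
  nonempty (there _) = s≤s z≤n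

variables : Formula → List Var
variables F = map proj₁ (concat F)

Any-Mentions⇒∈variables : ∀ {F v} → Any (Mentions v) F → v ∈ᴸ variables F
Any-Mentions⇒∈variables mentioned = AnyP.map⁺ (Any.map sym (AnyP.concat⁺ mentioned))

DistinctOfDegree2 : Formula → Var → Var → Set
DistinctOfDegree2 F a b = a ≢ b × degree F a ≡ 2 × degree F b ≡ 2

distinctOfDegree2? : ∀ F a b → Dec (DistinctOfDegree2 F a b)
distinctOfDegree2? F a b = ¬? (a ≟ b) ×-dec (degree F a ≟ 2) ×-dec (degree F b ≟ 2)

TwoOfDegree2 : Formula → Set
TwoOfDegree2 F = ∃₂ (DistinctOfDegree2 F)

twoOfDegree2⊎AtMostOneDeg2 : ∀ F → TwoOfDegree2 F ⊎ AtMostOneDeg2 F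
twoOfDegree2⊎AtMostOneDeg2 F with any? (λ a → any? (distinctOfDegree2? F a) (variables F)) (variables F)
... | yes p = let a , q = satisfied p ; b , r = satisfied q in inj₁ (a , b , r)
... | no ¬p = inj₂ λ a b da db → decidable-stable (a ≟ b) λ a≢b →
  ¬p (lose (∈variables da) (lose (∈variables db) (a≢b , da , db)))
  where
  ∈variables : ∀ {v} → degree F v ≡ 2 → v ∈ᴸ variables F
  ∈variables = Any-Mentions⇒∈variables ∘ degree≡2⇒Any-Mentions F

module Reduction
  (k : ℕ) (Bound : Formula → Set)
  (Bound-⊆ : ∀ {F G} → G ⊆ F → Bound F → Bound G)
  (Bound-merge : ∀ F x y t → AtMostOnce F x → AtMostOnce F y → Bound F → Bound (renameFormula x y t F))
  where

  Good : Formula → Set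
  Good F = IsFormula F × Uniform k F × Bound F

  Good-⊆ : ∀ {F G} → G ⊆ F → Good F → Good G
  Good-⊆ G⊆F (isFormula , uniform , bound) =
    IsFormula-⊆ G⊆F isFormula , All-resp-⊆ G⊆F uniform , Bound-⊆ G⊆F bound

  Smaller : Formula → Set
  Smaller F = Σ Formula λ G → Good G × Unsatisfiable G × size G ≤ size F × weight G < weight F

  removePure : ∀ {F} → Good F → Unsatisfiable F →
               ∀ v b → occ F (v , not b) ≡ 0 → degree F v ≡ 2 → Smaller F
  removePure {F} good unsat v b pure degree≡2 =
    removeClausesWith (v , b) F ,
    Good-⊆ (filter-⊆ _ F) good ,
    removeClausesWith-pure-Unsatisfiable F v b pure unsat ,
    length-filter _ F ,
    removeClausesWith-pure-weight-< F v b pure (degree≡2⇒Any-Mentions F degree≡2)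

  mergeOnce : ∀ {F x y} → Good F → Unsatisfiable F → x < y → Any (Mentions y) F →
              AtMostOnce F x → AtMostOnce F y → Smaller F
  mergeOnce {F} {x} {y} (isFormula , uniform , bound) unsat x<y y-mentioned x-once y-once
    with collisionFree-polarity (proj₁ isFormula) x-once y-once
  ... | t , ¬collides =
    merge x y t F ,
    (Identify.merge-IsFormula x y t (proj₁ isFormula) ¬collides ,
     All-resp-⊆ (Identify.merge-⊆ x y t F) (Identify.renameFormula-Uniform x y t uniform) ,
     Bound-⊆ (Identify.merge-⊆ x y t F) (Bound-merge F x y t x-once y-once bound)) ,
    Identify.merge-Unsatisfiable x y t F unsat ,
    Identify.merge-size x y t F ,
    Identify.merge-weight-< x y t x<y y-mentioned

  shrinkOrdered : ∀ {F x y} → Good F → Unsatisfiable F →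
                  x < y → degree F x ≡ 2 → degree F y ≡ 2 → Smaller F
  shrinkOrdered {F} {x} {y} good unsat x<y dx dy
    with pure⊎AtMostOnce (proj₁ (proj₁ good)) x dx | pure⊎AtMostOnce (proj₁ (proj₁ good)) y dy
  ... | inj₁ (b , pure) | _ = removePure good unsat x b pure dx
  ... | inj₂ _ | inj₁ (b , pure) = removePure good unsat y b pure dy
  ... | inj₂ x-once | inj₂ y-once = mergeOnce good unsat x<y (degree≡2⇒Any-Mentions F dy) x-once y-once

  shrink : ∀ {F} → Good F → Unsatisfiable F → TwoOfDegree2 F → Smaller F
  shrink good unsat (a , b , a≢b , da , db) with <-cmp a b
  ... | tri< a<b _ _ = shrinkOrdered good unsat a<b da db
  ... | tri≈ _ a≡b _ = contradiction a≡b a≢b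
  ... | tri> _ _ b<a = shrinkOrdered good unsat b<a db da

  Reduced : Formula → Set
  Reduced F = Σ Formula λ F′ → Good F′ × Unsatisfiable F′ × size F′ ≤ size F × AtMostOneDeg2 F′

  reduce : ∀ F → Acc _<_ (weight F) → Good F → Unsatisfiable F → Reduced F
  reduce F (acc smaller) good unsat with twoOfDegree2⊎AtMostOneDeg2 F
  ... | inj₂ atMostOne = F , good , unsat , ≤-refl , atMostOne
  ... | inj₁ two with shrink good unsat two
  ...   | G , goodG , unsatG , G≤F , G<F with reduce G (smaller G<F) goodG unsatG
  ...     | F′ , goodF′ , unsatF′ , F′≤G , atMostOne =
    F′ , goodF′ , unsatF′ , ≤-trans F′≤G G≤F , atMostOne

  reduced : ∀ F → Good F → Unsatisfiable F → Reduced F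
  reduced F = reduce F (<-wellFounded (weight F))

degree≤4-merge : ∀ F x y t → AtMostOnce F x → AtMostOnce F y →
                 (∀ v → degree F v ≤ 4) → ∀ v → degree (renameFormula x y t F) v ≤ 4
degree≤4-merge F x y t x-once y-once bound v with v ≟ x
... | yes refl = ≤-trans (Identify.degree-renameFormula-x x y t F)
                         (+-mono-≤ (AtMostOnce⇒degree≤2 {F} x-once) (AtMostOnce⇒degree≤2 {F} y-once))
... | no v≢x = ≤-trans (Identify.degree-renameFormula-other x y t F v≢x) (bound v)

occ≤2-merge : ∀ F x y t → AtMostOnce F x → AtMostOnce F y →
              ∀ v c → occ F (v , c) ≤ 2 → occ (renameFormula x y t F) (v , c) ≤ 2
occ≤2-merge F x y t x-once y-once v c bound with v ≟ x
... | yes refl = ≤-trans (Identify.occ-renameFormula-x x y t F c) (+-mono-≤ (x-once c) (y-once (t xor c)))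
... | no v≢x = ≤-trans (Identify.occ-renameFormula-other x y t F c v≢x) bound

module KS = Reduction 3 (λ F → ∀ v → degree F v ≤ 4)
  (λ G⊆F bound v → ≤-trans (count-mono-⊆ (mentions? v) G⊆F) (bound v))
  degree≤4-merge

module KPQ = Reduction 3 (λ F → ∀ v → posOcc F v ≤ 2 × negOcc F v ≤ 2)
  (λ G⊆F bound v → ≤-trans (count-mono-⊆ ((v , true) ∈?_) G⊆F) (proj₁ (bound v)) ,
                   ≤-trans (count-mono-⊆ ((v , false) ∈?_) G⊆F) (proj₂ (bound v)))
  (λ F x y t x-once y-once bound v → occ≤2-merge F x y t x-once y-once v true (proj₁ (bound v)) ,
                             occ≤2-merge F x y t x-once y-once v false (proj₂ (bound v)))

lemma12 : ((F : Formula) → IsKS 3 4 F → Unsatisfiable F →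
    Σ Formula (λ F′ → IsKS 3 4 F′ × Unsatisfiable F′ × size F′ ≤ size F × AtMostOneDeg2 F′))
    × ((F : Formula) → IsKPQ 3 2 2 F → Unsatisfiable F →
    Σ Formula (λ F′ → IsKPQ 3 2 2 F′ × Unsatisfiable F′ × size F′ ≤ size F × AtMostOneDeg2 F′))
lemma12 = KS.reduced , KPQ.reduced
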